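{- Let $p$ be a prime, let $n,m,k$ be positive integers, and for $1\le i\le k$ let $s_i,t_i$ be positive integers and $b_i\in\mathbb{F}_{p^m}$. Let $\delta\in\mathbb{F}_{p^{mn}}$. Let $f_1(x)$ be a polynomial over $\mathbb{F}_{p^{mn}}$ and $\varphi(x)$ a polynomial over $\mathbb{F}_{p^m}$ such that (i) $\mathrm{Tr}_m^{mn}(f_1(x))=\varphi(\mathrm{Tr}_m^{mn}(x))$ for all $x\in\mathbb{F}_{p^{mn}}$, and (ii) for every $a\in\mathbb{F}_{p^m}$, $f_1$ is injective on $\{x\in\mathbb{F}_{p^{mn}}:\mathrm{Tr}_m^{mn}(x)=a\}$. Then $$f(x)=\sum_{i=1}^k b_i\left(\mathrm{Tr}_m^{mn}(x)^{t_i}+\delta\right)^{s_i}+f_1(x)$$ permutes $\mathbb{F}_{p^{mn}}$ if and only if $$g(x)=\sum_{j=0}^{n-1}\sum_{i=1}^k b_i\left(x^{t_i}+\delta\right)^{s_ip^{mj}}+\varphi(x)$$ permutes $\mathbb{F}_{p^m}$. Moreover, if $f$ permutes $\mathbb{F}_{p^{mn}}$ and there exist polynomials $\phi(x),\bar\phi(x)$ over $\mathbb{F}_{p^{mn}}$ such that $\Psi(x):=\phi(f_1(x))+\bar\phi(\mathrm{Tr}_m^{mn}(x))$ permutes $\mathbb{F}_{p^{mn}}$, then, with $h(x)=\sum_{i=1}^k b_i(x^{t_i}+\delta)^{s_i}$, $g^{ -1}$ the compositional inverse of $g$ on $\mathbb{F}_{p^m}$, and $\Psi^{ -1}$ the compositional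 inverse of $\Psi$ on $\mathbb{F}_{p^{mn}}$, the compositional inverse of $f$ over $\mathbb{F}_{p^{mn}}$ is $$f^{ -1}(x)=\Psi^{ -1}\Big(\phi\big(x-h(g^{ -1}(\mathrm{Tr}_m^{mn}(x)))\big)+\bar\phi\big(g^{ -1}(\mathrm{Tr}_m^{mn}(x))\big)\Big).$$
   Context: $\mathrm{Tr}_m^{mn}:\mathbb{F}_{p^{mn}}\to\mathbb{F}_{p^m}$ is the trace map $\mathrm{Tr}_m^{mn}(x)=\sum_{j=0}^{n-1}x^{p^{jm}}$. The compositional inverse of a permutation polynomial $F$ of a finite field $\mathbb{F}$ is the unique polynomial map $F^{ -1}$ with $F(F^{ -1}(x))=F^{ -1}(F(x))=x$ for all $x\in\mathbb{F}$. -}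

module Defs where

open import Level using (0ℓ)
open import Data.Nat as ℕ using (ℕ; zero; suc)
open import Data.Fin using (Fin)
import Data.Fin as Fin
open import Data.List using (List; []; _∷_)
open import Data.Product using (_×_; ∃)
open import Relation.Nullary using (¬_)
open import Relation.Binary.PropositionalEquality using (_≡_)
open import Algebra.Structures using (IsCommutativeRing)
open import Function.Bundles using (_⤖_)

-- A finite field with exactly q elements, with propositional equality.
-- (Every finite field of order q = p^r is a model of F_q, unique up to iso.)
record FiniteField (q : ℕ) : Set₁ where
  infixl 6 _+_
  infixl 7 _*_
  field
    Carrier : Set
    _+_ _*_ : Carrier → Carrier → Carrier
    -_      : Carrier → Carrier
    0# 1#   : Carrier
    isCommutativeRing : IsCommutativeRing _≡_ _+_ _*_ -_ 0# 1#
    0≢1     : ¬ (0# ≡ 1#)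
    inverse : ∀ x → ¬ (x ≡ 0#) → ∃ λ y → x * y ≡ 1#
    card    : Fin q ⤖ Carrier

module FieldOps {q : ℕ} (F : FiniteField q) where
  open FiniteField F public

  infixl 6 _-_
  _-_ : Carrier → Carrier → Carrier
  x - y = x + (- y)

  infixr 8 _^_
  _^_ : Carrier → ℕ → Carrier
  x ^ zero  = 1#
  x ^ suc e = x * (x ^ e)

  sumFin : (k : ℕ) → (Fin k → Carrier) → Carrier
  sumFin zero    f = 0#
  sumFin (suc k) f = f Fin.zero + sumFin k (λ i → f (Fin.suc i))

  -- polynomials as coefficient lists (constant term first), Horner evaluation
  Poly : Set
  Poly = List Carrier

  eval : Poly → Carrier → Carrier
  eval []       x = 0#
  eval (c ∷ cs) x = c + x * eval cs x

  -- membership in the subfield F_{p^m} = { x : x^(p^m) = x }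
  InSub : (p m : ℕ) → Carrier → Set
  InSub p m x = x ^ (p ℕ.^ m) ≡ x

  data PolyOver (p m : ℕ) : Poly → Set where
    []  : PolyOver p m []
    _∷_ : ∀ {c cs} → InSub p m c → PolyOver p m cs → PolyOver p m (c ∷ cs)

  Tr : (p m n : ℕ) → Carrier → Carrier
  Tr p m n x = sumFin n (λ j → x ^ (p ℕ.^ (Fin.toℕ j ℕ.* m)))

  Permutes : (Carrier → Carrier) → Set
  Permutes f = (∀ x y → f x ≡ f y → x ≡ y) × (∀ y → ∃ λ x → f x ≡ y)

  PermutesSub : (p m : ℕ) → (Carrier → Carrier) → Set
  PermutesSub p m g =
    (∀ x → InSub p m x → InSub p m (g x)) ×
    (∀ x y → InSub p m x → InSub p m y → g x ≡ g y → x ≡ y) ×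
    (∀ y → InSub p m y → ∃ λ x → InSub p m x × g x ≡ y)

  InverseOnSub : (p m : ℕ) → (Carrier → Carrier) → (Carrier → Carrier) → Set
  InverseOnSub p m g ginv =
    (∀ y → InSub p m y → InSub p m (ginv y)) ×
    (∀ y → InSub p m y → g (ginv y) ≡ y) ×
    (∀ x → InSub p m x → ginv (g x) ≡ x)

  InverseOf : (Carrier → Carrier) → (Carrier → Carrier) → Set
  InverseOf f finv = (∀ x → f (finv x) ≡ x) × (∀ x → finv (f x) ≡ x)

{-# OPTIONS --safe #-}
-- Tr = Tr_m^{mn} is additive, F_{p^m}-linear and maps K onto F_{p^m}, and Tr (h a) is the double
-- sum in g, so Tr ∘ f = g ∘ Tr.  If f is onto, so is g on F_{p^m}, hence g is also one-to-one there,
-- the subfield being finite.  Conversely f x = f y gives g (Tr x) = g (Tr y), so Tr x = Tr y, so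
-- f₁ x = f₁ y and x = y; a one-to-one self-map of the finite field K is onto.  Finally
-- g⁻¹ (Tr (f y)) = Tr y, so x - h (g⁻¹ (Tr x)) is f₁ (f⁻¹ x), and Ψ⁻¹ removes ϕ and ϕ̄.
module Submission where

open import Defs
open import Data.Nat as ℕ using (ℕ)
open import Data.Fin using (Fin)
open import Data.Product using (_×_)
open import Data.Nat.Primality using (Prime)
open import Relation.Binary.PropositionalEquality using (_≡_)
open import Function.Bundles using (_⇔_)

open import Level using (0ℓ)
open import Data.Nat using (zero; suc; _∸_; _!; z≤n; s≤s; _≤_; _<_)
import Data.Nat.Properties as ℕP
import Data.Fin as Fin
import Data.Fin.Properties as FinP
open import Data.Product using (_,_; ∃; proj₁; proj₂)
open import Data.Sum using (inj₁; inj₂)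
open import Data.List using (List; []; _∷_; length; tabulate)
open import Data.List.Relation.Unary.All as All using (All; []; _∷_)
open import Function using (_∘_)
open import Function.Bundles using (_↔_; Inverse; mk⇔; mk↔ₛ′)
open import Function.Construct.Composition using (_↔-∘_)
open import Function.Construct.Symmetry using (↔-sym)
open import Function.Properties.Bijection using (⤖⇒↔)
open import Relation.Nullary using (¬_; yes; no; contradiction)
open import Relation.Nullary.Decidable using (map′)
open import Relation.Unary using (Decidable)
open import Relation.Binary.Definitions using (DecidableEquality)
open import Relation.Binary.PropositionalEquality
  using (refl; sym; trans; cong; cong₂; subst; subst₂; module ≡-Reasoning)
open import Algebra.Bundles using (CommutativeMonoid; CommutativeRing)
import Algebra.Properties.CommutativeMonoid.Sum as CommutativeMonoidSum
import Algebra.Properties.CommutativeSemiring.Exp as CommutativeSemiringExp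
import Algebra.Properties.CommutativeSemiring.Binomial as CommutativeSemiringBinomial
import Algebra.Properties.Group as GroupProperties
import Algebra.Properties.CommutativeSemigroup as CommutativeSemigroupProperties
import Algebra.Properties.Semiring.Mult as SemiringMult
open import Data.Vec.Functional using (init; removeAt)
open import Data.Maybe using (nothing)
open import Data.Nat.Divisibility using (_∣_; divides; ∣⇒≤; ∣1⇒≡1; m∣m*n)
open import Data.Nat.Primality using (euclidsLemma; prime⇒nonTrivial; prime⇒nonZero)
open import Data.Nat.Combinatorics using (_C_; nCk≡n!/k![n-k]!; k![n∸k]!∣n!; nCn≡1)
open import Data.Nat.DivMod using (m/n*n≡m)
import Data.List.Properties as ListP
import Data.List.Relation.Unary.All.Properties as AllP
open import Data.List.Relation.Unary.Unique.Propositional using (Unique)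
open import Data.List.Relation.Unary.AllPairs using (_∷_)
import Data.List.Relation.Unary.Unique.Propositional.Properties as UniqueP
open import Tactic.RingSolver.Core.AlmostCommutativeRing using (fromCommutativeRing)
import Tactic.RingSolver.NonReflective as RingSolver

prime∤k! : ∀ {p k} → Prime p → k < p → ¬ (p ∣ k !)
prime∤k! {p} {zero}  p-prime _   p∣1 =
  ℕP.<-irrefl (sym (∣1⇒≡1 p∣1)) (ℕ.nonTrivial⇒n>1 p {{prime⇒nonTrivial p-prime}})
prime∤k! {p} {suc k} p-prime k<p p∣[1+k]! with euclidsLemma (suc k) (k !) p-prime p∣[1+k]!
... | inj₁ p∣1+k = ℕP.<⇒≱ k<p (∣⇒≤ p∣1+k)
... | inj₂ p∣k!  = prime∤k! p-prime (ℕP.<-trans (ℕP.n<1+n k) k<p) p∣k!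

n∣n! : ∀ n → .{{ℕ.NonZero n}} → n ∣ n !
n∣n! (suc n) = m∣m*n (n !)

nCk*k![n∸k]!≡n! : ∀ {n k} → k ≤ n → (n C k) ℕ.* (k ! ℕ.* (n ∸ k) !) ≡ n !
nCk*k![n∸k]!≡n! {n} {k} k≤n = trans (cong (ℕ._* (k ! ℕ.* (n ∸ k) !)) (nCk≡n!/k![n-k]! k≤n))
                                    (m/n*n≡m {{ℕP._!*_!≢0 k (n ∸ k)}} (k![n∸k]!∣n! k≤n))

prime∣pCk : ∀ {p k} → Prime p → 0 < k → k < p → p ∣ p C k
prime∣pCk {p} {k} p-prime 0<k k<p
  with euclidsLemma (p C k) (k ! ℕ.* (p ∸ k) !) p-prime
         (subst (p ∣_) (sym (nCk*k![n∸k]!≡n! (ℕP.<⇒≤ k<p))) (n∣n! p {{prime⇒nonZero p-prime}}))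
... | inj₁ p∣pCk = p∣pCk
... | inj₂ p∣k![p∸k]! with euclidsLemma (k !) ((p ∸ k) !) p-prime p∣k![p∸k]!
...   | inj₁ p∣k!     = contradiction p∣k! (prime∤k! p-prime k<p)
...   | inj₂ p∣[p∸k]! =
  contradiction p∣[p∸k]! (prime∤k! p-prime (ℕP.∸-monoʳ-< {p} {k} {0} 0<k (ℕP.<⇒≤ k<p)))

module Enumerated {A : Set} {q : ℕ} (enum : Fin q ↔ A) where
  open Inverse enum using (to; from; strictlyInverseˡ; strictlyInverseʳ)

  from-injective : ∀ {x y} → from x ≡ from y → x ≡ y
  from-injective {x} {y} eq = begin
    x             ≡⟨ strictlyInverseˡ x ⟨
    to (from x)   ≡⟨ cong to eq ⟩
    to (from y)   ≡⟨ strictlyInverseˡ y ⟩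
    y             ∎
    where open ≡-Reasoning

  to-injective : ∀ {i j} → to i ≡ to j → i ≡ j
  to-injective {i} {j} eq = trans (sym (strictlyInverseʳ i)) (trans (cong from eq) (strictlyInverseʳ j))

  infix 4 _≟_
  _≟_ : DecidableEquality A
  x ≟ y = map′ from-injective (cong from) (from x Fin.≟ from y)

  ¬∀⇒∃¬ : {P : A → Set} → Decidable P → ¬ (∀ x → P x) → ∃ λ x → ¬ P x
  ¬∀⇒∃¬ {P} P? ¬∀P =
    let i , ¬P[to-i] = FinP.¬∀⟶∃¬ q (P ∘ to) (P? ∘ to)
                         (λ ∀P → ¬∀P (λ x → subst P (strictlyInverseˡ x) (∀P (from x))))
    in to i , ¬P[to-i]

  fin-injective⇒surjective : ∀ {n} (f : Fin n → Fin n) → (∀ {i j} → f i ≡ f j → i ≡ j) →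
                             ∀ j → ∃ λ i → f i ≡ j
  fin-injective⇒surjective {suc n} f inj j with FinP.any? (λ i → f i Fin.≟ j)
  ... | yes hit  = hit
  ... | no  miss = contradiction (FinP.injective⇒≤ avoid-j-injective) ℕP.1+n≰n
    where
    avoid-j : Fin (suc n) → Fin n
    avoid-j i = Fin.punchOut {i = j} {j = f i} (λ j≡fi → miss (i , sym j≡fi))
    avoid-j-injective : ∀ {i i′} → avoid-j i ≡ avoid-j i′ → i ≡ i′
    avoid-j-injective eq = inj (FinP.punchOut-injective {i = j} _ _ eq)

  injective⇒surjective : (f : A → A) → (∀ {x y} → f x ≡ f y → x ≡ y) → ∀ y → ∃ λ x → f x ≡ y
  injective⇒surjective f inj y =
    let i , fi≡y = fin-injective⇒surjective (from ∘ f ∘ to)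
                     (λ eq → to-injective (inj (from-injective eq))) (from y)
    in to i , from-injective fi≡y

  -- A right inverse of g on P is injective on all of A once extended by the identity off P,
  -- hence onto, so it is also a left inverse of g on P.
  surjectiveOn⇒injectiveOn : {P : A → Set} → Decidable P → (g : A → A) →
                             (∀ y → P y → ∃ λ x → P x × g x ≡ y) →
                             ∀ x y → P x → P y → g x ≡ g y → x ≡ y
  surjectiveOn⇒injectiveOn {P} P? g onto x y Px Py gx≡gy =
    trans (section-of-g x Px) (trans (cong section gx≡gy) (sym (section-of-g y Py)))
    where
    section : A → A
    section y with P? y
    ... | yes Py = proj₁ (onto y Py)
    ... | no  _  = y
    g-section : ∀ {y} → P y → g (section y) ≡ y
    g-section {y} Py with P? y
    ... | yes Py′ = proj₂ (proj₂ (onto y Py′))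
    ... | no ¬Py  = contradiction Py ¬Py
    section-injective : ∀ {y y′} → section y ≡ section y′ → y ≡ y′
    section-injective {y} {y′} eq with P? y | P? y′
    ... | yes Py | yes Py′ =
      trans (sym (proj₂ (proj₂ (onto y Py)))) (trans (cong g eq) (proj₂ (proj₂ (onto y′ Py′))))
    ... | yes Py | no ¬Py′ = contradiction (subst P eq (proj₁ (proj₂ (onto y Py)))) ¬Py′
    ... | no ¬Py | yes Py′ = contradiction (subst P (sym eq) (proj₁ (proj₂ (onto y′ Py′)))) ¬Py
    ... | no _   | no _    = eq
    section-reflects-P : ∀ {y} → P (section y) → P y
    section-reflects-P {y} P[section-y] with P? y
    ... | yes Py = Py
    ... | no  _  = P[section-y]
    section-of-g : ∀ x → P x → x ≡ section (g x)
    section-of-g x Px with injective⇒surjective section section-injective x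
    ... | y , refl = cong section (sym (g-section (section-reflects-P Px)))

  module _ {c ℓ} (M : CommutativeMonoid c ℓ) where
    open CommutativeMonoid M using (Carrier; _≈_) renaming (trans to ≈-trans; reflexive to ≈-reflexive)
    open CommutativeMonoidSum M using (sum; sum-permute; sum-cong-≗)

    sum-reindex : (σ : A ↔ A) (F : A → Carrier) → sum (F ∘ to) ≈ sum (F ∘ Inverse.to σ ∘ to)
    sum-reindex σ F =
      ≈-trans (sum-permute (F ∘ to) π) (≈-reflexive (sum-cong-≗ (cong F ∘ strictlyInverseˡ ∘ σ.to ∘ to)))
      where
      module σ = Inverse σ
      π = ↔-sym enum ↔-∘ (σ ↔-∘ enum)

module FiniteFieldTheory {q : ℕ} (K : FiniteField q) where
  open FieldOps K
  open ≡-Reasoning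

  commutativeRing : CommutativeRing 0ℓ 0ℓ
  commutativeRing = record { isCommutativeRing = isCommutativeRing }

  open CommutativeRing commutativeRing public
    using ( +-comm; +-assoc; *-comm; *-assoc; +-identityˡ; +-identityʳ; *-identityˡ; *-identityʳ
          ; distribˡ; zeroˡ; zeroʳ
          ; +-commutativeMonoid; *-commutativeMonoid; semiring; commutativeSemiring )
  private
    module +G = GroupProperties (CommutativeRing.+-group commutativeRing)
    module Exp = CommutativeSemiringExp commutativeSemiring
    module Σ = CommutativeMonoidSum +-commutativeMonoid
    module Π = CommutativeMonoidSum *-commutativeMonoid

  open +G public
    using () renaming (∙-cancelˡ to +-cancelˡ; identityʳ-unique to +-identityʳ-unique; x∙y⁻¹≈ε⇒x≈y to x-y≡0⇒x≡y)
  open CommutativeSemigroupProperties (CommutativeMonoid.commutativeSemigroup +-commutativeMonoid) public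
    using () renaming (interchange to +-interchange)
  open SemiringMult semiring public
    using () renaming (_×_ to _·_; ×1-homo-* to ·1-homo-*; ×-assoc-* to ·-assoc-*)

  enumeration : Fin q ↔ Carrier
  enumeration = ⤖⇒↔ card

  open Enumerated enumeration public
  open Inverse enumeration using (to; from; strictlyInverseˡ)

  x-y+y≡x : ∀ x y → x - y + y ≡ x
  x-y+y≡x x y = +G.//-rightDividesˡ y x

  x+y-y≡x : ∀ x y → x + y - y ≡ x
  x+y-y≡x x y = +G.//-rightDividesʳ y x

  x+y-x≡y : ∀ x y → x + y - x ≡ y
  x+y-x≡y x y = trans (cong (_- x) (+-comm x y)) (x+y-y≡x y x)

  1#≢0# : ¬ (1# ≡ 0#)
  1#≢0# = 0≢1 ∘ sym

  *-cancelˡ : ∀ {x} → ¬ (x ≡ 0#) → ∀ {y z} → x * y ≡ x * z → y ≡ z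
  *-cancelˡ {x} x≢0 {y} {z} xy≡xz = trans (sym (x⁻¹[xw]≡w y)) (trans (cong (x⁻¹ *_) xy≡xz) (x⁻¹[xw]≡w z))
    where
    x⁻¹ = proj₁ (inverse x x≢0)
    x⁻¹[xw]≡w : ∀ w → x⁻¹ * (x * w) ≡ w
    x⁻¹[xw]≡w w = begin
      x⁻¹ * (x * w) ≡⟨ *-assoc x⁻¹ x w ⟨
      (x⁻¹ * x) * w ≡⟨ cong (_* w) (trans (*-comm x⁻¹ x) (proj₂ (inverse x x≢0))) ⟩
      1# * w        ≡⟨ *-identityˡ w ⟩
      w             ∎

  *-nonzero : ∀ {x y} → ¬ (x ≡ 0#) → ¬ (y ≡ 0#) → ¬ (x * y ≡ 0#)
  *-nonzero {x} x≢0 y≢0 xy≡0 = y≢0 (*-cancelˡ x≢0 (trans xy≡0 (sym (zeroʳ x))))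

  ^≡Exp^ : ∀ x n → x ^ n ≡ x Exp.^ n
  ^≡Exp^ x zero    = refl
  ^≡Exp^ x (suc n) = cong (x *_) (^≡Exp^ x n)

  ^-distrib-* : ∀ x y n → (x * y) ^ n ≡ x ^ n * y ^ n
  ^-distrib-* x y n rewrite ^≡Exp^ (x * y) n | ^≡Exp^ x n | ^≡Exp^ y n = Exp.^-distrib-* x y n

  ^-distribˡ-+-* : ∀ x m n → x ^ (m ℕ.+ n) ≡ x ^ m * x ^ n
  ^-distribˡ-+-* x m n rewrite ^≡Exp^ x (m ℕ.+ n) | ^≡Exp^ x m | ^≡Exp^ x n = Exp.^-homo-* x m n

  ^-*-assoc : ∀ x m n → (x ^ m) ^ n ≡ x ^ (m ℕ.* n)
  ^-*-assoc x m n rewrite ^≡Exp^ (x ^ m) n | ^≡Exp^ x m | ^≡Exp^ x (m ℕ.* n) = Exp.^-assocʳ x m n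

  1#^n≡1# : ∀ n → 1# ^ n ≡ 1#
  1#^n≡1# zero    = refl
  1#^n≡1# (suc n) = trans (*-identityˡ _) (1#^n≡1# n)

  0#^n≡0# : ∀ {n} → 0 < n → 0# ^ n ≡ 0#
  0#^n≡0# {suc n} _ = zeroˡ _

  ^-nonzero : ∀ {x} n → ¬ (x ≡ 0#) → ¬ (x ^ n ≡ 0#)
  ^-nonzero zero    x≢0 = 1#≢0#
  ^-nonzero (suc n) x≢0 = *-nonzero x≢0 (^-nonzero n x≢0)

  sumFin-cong : ∀ k {f g : Fin k → Carrier} → (∀ i → f i ≡ g i) → sumFin k f ≡ sumFin k g
  sumFin-cong zero    f≗g = refl
  sumFin-cong (suc k) f≗g = cong₂ _+_ (f≗g Fin.zero) (sumFin-cong k (f≗g ∘ Fin.suc))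

  sumFin-distrib-+ : ∀ k (f g : Fin k → Carrier) → sumFin k (λ i → f i + g i) ≡ sumFin k f + sumFin k g
  sumFin-distrib-+ zero    f g = sym (+-identityˡ 0#)
  sumFin-distrib-+ (suc k) f g = trans (cong (_ +_) (sumFin-distrib-+ k (f ∘ Fin.suc) (g ∘ Fin.suc)))
                                       (+-interchange _ _ _ _)

  *-distribˡ-sumFin : ∀ k c (f : Fin k → Carrier) → c * sumFin k f ≡ sumFin k (λ i → c * f i)
  *-distribˡ-sumFin zero    c f = zeroʳ c
  *-distribˡ-sumFin (suc k) c f = trans (distribˡ c _ _) (cong (_ +_) (*-distribˡ-sumFin k c (f ∘ Fin.suc)))

  sumFin-const : ∀ k c → sumFin k (λ _ → c) ≡ k · c
  sumFin-const zero    c = refl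
  sumFin-const (suc k) c = cong (c +_) (sumFin-const k c)

  sumFin-init-last : ∀ k (f : Fin (suc k) → Carrier) →
                     sumFin (suc k) f ≡ sumFin k (f ∘ Fin.inject₁) + f (Fin.fromℕ k)
  sumFin-init-last zero    f = trans (+-identityʳ _) (sym (+-identityˡ _))
  sumFin-init-last (suc k) f = trans (cong (_ +_) (sumFin-init-last k (f ∘ Fin.suc))) (sym (+-assoc _ _ _))

  sumFin-rotate : ∀ k (G : ℕ → Carrier) → G k ≡ G 0 →
                  sumFin k (λ j → G (suc (Fin.toℕ j))) ≡ sumFin k (λ j → G (Fin.toℕ j))
  sumFin-rotate zero    G _       = refl
  sumFin-rotate (suc k) G Gk≡G0 = begin
    sumFin (suc k) (λ j → G (suc (Fin.toℕ j)))
      ≡⟨ sumFin-init-last k (λ j → G (suc (Fin.toℕ j))) ⟩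
    sumFin k (λ j → G (suc (Fin.toℕ (Fin.inject₁ j)))) + G (suc (Fin.toℕ (Fin.fromℕ k)))
      ≡⟨ cong₂ _+_ (sumFin-cong k (λ j → cong (G ∘ suc) (FinP.toℕ-inject₁ j)))
                   (trans (cong (G ∘ suc) (FinP.toℕ-fromℕ k)) Gk≡G0) ⟩
    sumFin k (λ j → G (suc (Fin.toℕ j))) + G 0
      ≡⟨ +-comm _ _ ⟩
    sumFin (suc k) (λ j → G (Fin.toℕ j))
      ∎

  sumFin≡sum : ∀ k (f : Fin k → Carrier) → sumFin k f ≡ Σ.sum f
  sumFin≡sum zero    f = refl
  sumFin≡sum (suc k) f = cong (f Fin.zero +_) (sumFin≡sum k (f ∘ Fin.suc))

  ∏ : ∀ {k} → (Fin k → Carrier) → Carrier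
  ∏ = Π.sum

  ∏-nonzero : ∀ {k} (f : Fin k → Carrier) → (∀ i → ¬ (f i ≡ 0#)) → ¬ (∏ f ≡ 0#)
  ∏-nonzero {zero}  f f≢0 = 1#≢0#
  ∏-nonzero {suc k} f f≢0 = *-nonzero (f≢0 Fin.zero) (∏-nonzero (f ∘ Fin.suc) (f≢0 ∘ Fin.suc))

  ∏-single : ∀ {k} (f : Fin k → Carrier) i → (∀ j → ¬ (j ≡ i) → f j ≡ 1#) → ∏ f ≡ f i
  ∏-single {suc k} f i others = begin
    ∏ f                      ≡⟨ Π.sum-remove {i = i} f ⟩
    f i * ∏ (removeAt f i)   ≡⟨ cong (f i *_) all-one ⟩
    f i * 1#                 ≡⟨ *-identityʳ (f i) ⟩
    f i                      ∎
    where
    all-one : ∏ (removeAt f i) ≡ 1#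
    all-one = trans (Π.sum-cong-≗ (λ j → others _ (FinP.punchInᵢ≢i i j))) (Π.sum-replicate-zero k)

  translation : Carrier → Carrier ↔ Carrier
  translation a = mk↔ₛ′ (_+ a) (_- a) (λ y → x-y+y≡x y a) (λ x → x+y-y≡x x a)

  scaling : ∀ {a} → ¬ (a ≡ 0#) → Carrier ↔ Carrier
  scaling {a} a≢0 = mk↔ₛ′ (a *_) (a⁻¹ *_) (λ y → trans (sym (*-assoc a a⁻¹ y)) (aa⁻¹y≡y y))
                         (λ x → trans (sym (*-assoc a⁻¹ a x)) (trans (cong (_* x) (*-comm a⁻¹ a)) (aa⁻¹y≡y x)))
    where
    a⁻¹ = proj₁ (inverse a a≢0)
    aa⁻¹y≡y : ∀ y → (a * a⁻¹) * y ≡ y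
    aa⁻¹y≡y y = trans (cong (_* y) (proj₂ (inverse a a≢0))) (*-identityˡ y)

  q·1#≡0# : q · 1# ≡ 0#
  q·1#≡0# = +-identityʳ-unique S (q · 1#) (begin
    S + q · 1#                  ≡⟨ cong (S +_) (sumFin-const q 1#) ⟨
    S + sumFin q (λ _ → 1#)     ≡⟨ sumFin-distrib-+ q to (λ _ → 1#) ⟨
    sumFin q (λ i → to i + 1#)  ≡⟨ sumFin≡sum q _ ⟩
    Σ.sum (λ i → to i + 1#)     ≡⟨ sum-reindex +-commutativeMonoid (translation 1#) (λ x → x) ⟨
    Σ.sum to                    ≡⟨ sumFin≡sum q to ⟨
    S                           ∎)
    where
    S = sumFin q to

  ·1#-homo-^ : ∀ p r → (p ℕ.^ r) · 1# ≡ (p · 1#) ^ r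
  ·1#-homo-^ p zero    = +-identityʳ 1#
  ·1#-homo-^ p (suc r) = trans (·1-homo-* p (p ℕ.^ r)) (cong (p · 1# *_) (·1#-homo-^ p r))

  p^r≡q⇒p·1#≡0# : ∀ p r → p ℕ.^ r ≡ q → p · 1# ≡ 0#
  p^r≡q⇒p·1#≡0# p r p^r≡q with p · 1# ≟ 0#
  ... | yes p·1#≡0# = p·1#≡0#
  ... | no  p·1#≢0# = contradiction (trans (sym (·1#-homo-^ p r)) (trans (cong (_· 1#) p^r≡q) q·1#≡0#))
                                    (^-nonzero r p·1#≢0#)

  -- With u y the element y with 0 replaced by 1, reindexing ∏ u(y) along y ↦ x * y gives
  -- ∏ u(y) * x = x^q * ∏ u(y); the extra factor x accounts for y = 0.
  fermat : ∀ x → x ^ q ≡ x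
  fermat x with x ≟ 0#
  ... | yes refl = 0#^n≡0# (ℕP.≤-<-trans z≤n (FinP.toℕ<n (from 0#)))
  ... | no x≢0 = sym (*-cancelˡ (∏-nonzero (u ∘ to) (u-nonzero ∘ to)) (begin
    P * x
      ≡⟨ cong₂ _*_ (sum-reindex *-commutativeMonoid (scaling x≢0) u) (sym ∏-correction) ⟩
    ∏ (λ i → u (x * to i)) * ∏ (correction ∘ to)
      ≡⟨ Π.∑-distrib-+ (λ i → u (x * to i)) (correction ∘ to) ⟨
    ∏ (λ i → u (x * to i) * correction (to i))
      ≡⟨ Π.sum-cong-≗ (u-scale ∘ to) ⟩
    ∏ (λ i → x * u (to i))
      ≡⟨ Π.∑-distrib-+ {q} (λ _ → x) (u ∘ to) ⟩
    ∏ {q} (λ _ → x) * P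
      ≡⟨ cong (_* P) (trans (Π.sum-replicate q {x}) (sym (^≡Exp^ x q))) ⟩
    x ^ q * P
      ≡⟨ *-comm _ P ⟩
    P * x ^ q
      ∎))
    where
    u : Carrier → Carrier
    u y with y ≟ 0#
    ... | yes _ = 1#
    ... | no  _ = y
    P = ∏ (u ∘ to)
    u-nonzero : ∀ y → ¬ (u y ≡ 0#)
    u-nonzero y with y ≟ 0#
    ... | yes _   = 1#≢0#
    ... | no  y≢0 = y≢0
    correction : Carrier → Carrier
    correction y with y ≟ 0#
    ... | yes _ = x
    ... | no  _ = 1#
    u-scale : ∀ y → u (x * y) * correction y ≡ x * u y
    u-scale y with y ≟ 0# | x * y ≟ 0#
    ... | yes _   | yes _     = trans (*-identityˡ x) (sym (*-identityʳ x))
    ... | yes y≡0 | no xy≢0   = contradiction (trans (cong (x *_) y≡0) (zeroʳ x)) xy≢0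
    ... | no  y≢0 | yes xy≡0  = contradiction xy≡0 (*-nonzero x≢0 y≢0)
    ... | no  _   | no  _     = *-identityʳ (x * y)
    ∏-correction : ∏ (correction ∘ to) ≡ x
    ∏-correction = trans (∏-single (correction ∘ to) (from 0#) correction-elsewhere)
                         (trans (cong correction (strictlyInverseˡ 0#)) correction-at-0)
      where
      correction-at-0 : correction 0# ≡ x
      correction-at-0 with 0# ≟ 0#
      ... | yes _   = refl
      ... | no  0≢0 = contradiction refl 0≢0
      correction-elsewhere : ∀ j → ¬ (j ≡ from 0#) → correction (to j) ≡ 1#
      correction-elsewhere j j≢0 with to j ≟ 0#
      ... | yes to-j≡0 = contradiction (to-injective (trans to-j≡0 (sym (strictlyInverseˡ 0#)))) j≢0
      ... | no  _      = refl

  monomial : ℕ → Poly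
  monomial zero    = 1# ∷ []
  monomial (suc e) = 0# ∷ monomial e

  eval-monomial : ∀ e x → eval (monomial e) x ≡ x ^ e
  eval-monomial zero    x = trans (cong (1# +_) (zeroʳ x)) (+-identityʳ 1#)
  eval-monomial (suc e) x = trans (+-identityˡ _) (cong (x *_) (eval-monomial e x))

  length-monomial : ∀ e → length (monomial e) ≡ suc e
  length-monomial zero    = refl
  length-monomial (suc e) = cong suc (length-monomial e)

  monomial-nonzero : ∀ e → ¬ All (_≡ 0#) (monomial e)
  monomial-nonzero zero    (1#≡0# ∷ []) = 1#≢0# 1#≡0#
  monomial-nonzero (suc e) (_ ∷ zeros)  = monomial-nonzero e zeros

  infixl 6 _⊞_
  _⊞_ : Poly → Poly → Poly
  []       ⊞ bs       = bs
  (a ∷ as) ⊞ []       = a ∷ as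
  (a ∷ as) ⊞ (b ∷ bs) = a + b ∷ as ⊞ bs

  eval-⊞ : ∀ as bs x → eval (as ⊞ bs) x ≡ eval as x + eval bs x
  eval-⊞ []       bs       x = sym (+-identityˡ _)
  eval-⊞ (a ∷ as) []       x = sym (+-identityʳ _)
  eval-⊞ (a ∷ as) (b ∷ bs) x = begin
    a + b + x * eval (as ⊞ bs) x    ≡⟨ cong (λ e → a + b + x * e) (eval-⊞ as bs x) ⟩
    a + b + x * (A + B)             ≡⟨ cong (a + b +_) (distribˡ x A B) ⟩
    a + b + (x * A + x * B)         ≡⟨ +-interchange a b (x * A) (x * B) ⟩
    (a + x * A) + (b + x * B)       ∎
    where
    A = eval as x
    B = eval bs x

  length-⊞ : ∀ {N} as bs → length as ≤ N → length bs ≤ N → length (as ⊞ bs) ≤ N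
  length-⊞ []       bs       _           |bs|≤N      = |bs|≤N
  length-⊞ (a ∷ as) []       |as|≤N      _           = |as|≤N
  length-⊞ (a ∷ as) (b ∷ bs) (s≤s |as|≤N) (s≤s |bs|≤N) = s≤s (length-⊞ as bs |as|≤N |bs|≤N)

  ⊞-monomial-nonzero : ∀ as e → length as ≤ e → ¬ All (_≡ 0#) (as ⊞ monomial e)
  ⊞-monomial-nonzero []       e       _            zeros       = monomial-nonzero e zeros
  ⊞-monomial-nonzero (a ∷ as) (suc e) (s≤s |as|≤e) (_ ∷ zeros) = ⊞-monomial-nonzero as e |as|≤e zeros

  powerSum : ∀ k → (Fin k → ℕ) → Poly
  powerSum zero    e = []
  powerSum (suc k) e = monomial (e Fin.zero) ⊞ powerSum k (e ∘ Fin.suc)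

  eval-powerSum : ∀ k e x → eval (powerSum k e) x ≡ sumFin k (λ j → x ^ e j)
  eval-powerSum zero    e x = refl
  eval-powerSum (suc k) e x = trans (eval-⊞ (monomial (e Fin.zero)) _ x)
                                    (cong₂ _+_ (eval-monomial (e Fin.zero) x) (eval-powerSum k (e ∘ Fin.suc) x))

  length-powerSum : ∀ {N} k e → (∀ j → e j < N) → length (powerSum k e) ≤ N
  length-powerSum zero    e e<N = z≤n
  length-powerSum (suc k) e e<N =
    length-⊞ (monomial (e Fin.zero)) _ (subst (_≤ _) (sym (length-monomial (e Fin.zero))) (e<N Fin.zero))
             (length-powerSum k (e ∘ Fin.suc) (e<N ∘ Fin.suc))

  head-zero : ∀ {c r e} → e ≡ 0# → c + r * e ≡ 0# → c ≡ 0#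
  head-zero {c} {r} refl c+r*0≡0 = trans (sym (trans (cong (c +_) (zeroʳ r)) (+-identityʳ c))) c+r*0≡0

  -- divide r cs is the quotient of c ∷ cs by (X - r), whatever c is.
  divide : Carrier → Poly → Poly
  divide r []       = []
  divide r (c ∷ cs) = eval (c ∷ cs) r ∷ divide r cs

  length-divide : ∀ r cs → length (divide r cs) ≡ length cs
  length-divide r []       = refl
  length-divide r (c ∷ cs) = cong suc (length-divide r cs)

  factor-theorem : ∀ r c cs x → eval (c ∷ cs) x ≡ eval (c ∷ cs) r + (x - r) * eval (divide r cs) x
  factor-theorem r c [] x = begin
    c + x * 0#                        ≡⟨ cong (c +_) (zeroʳ x) ⟩
    c + 0#                            ≡⟨ +-identityʳ (c + 0#) ⟨
    (c + 0#) + 0#                     ≡⟨ cong₂ (λ u v → c + u + v) (zeroʳ r) (zeroʳ (x - r)) ⟨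
    (c + r * 0#) + (x - r) * 0#       ∎
  factor-theorem r c (c′ ∷ cs) x = begin
    c + x * eval (c′ ∷ cs) x                ≡⟨ cong (λ e → c + x * e) (factor-theorem r c′ cs x) ⟩
    c + x * (E + (x - r) * D)               ≡⟨ cong (λ y → c + y * (E + (x - r) * D)) (x-y+y≡x x r) ⟨
    c + (x - r + r) * (E + (x - r) * D)     ≡⟨ solve 5 (λ c d r E D → (c ⊕ (d ⊕ r) ⊗ (E ⊕ d ⊗ D))
                                                                    ⊜ ((c ⊕ r ⊗ E) ⊕ d ⊗ (E ⊕ (d ⊕ r) ⊗ D)))
                                                      refl c (x - r) r E D ⟩
    c + r * E + (x - r) * (E + (x - r + r) * D)
                                            ≡⟨ cong (λ y → c + r * E + (x - r) * (E + y * D)) (x-y+y≡x x r) ⟩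
    c + r * E + (x - r) * (E + x * D)       ∎
    where
    open RingSolver (fromCommutativeRing commutativeRing (λ _ → nothing))
    E = eval (c′ ∷ cs) r
    D = eval (divide r cs) x

  divide-zero⇒zero : ∀ r c cs → eval (c ∷ cs) r ≡ 0# → All (_≡ 0#) (divide r cs) → All (_≡ 0#) (c ∷ cs)
  divide-zero⇒zero r c []        P[r]≡0 []                = head-zero refl P[r]≡0 ∷ []
  divide-zero⇒zero r c (c′ ∷ cs) P[r]≡0 (P′[r]≡0 ∷ zeros) =
    head-zero P′[r]≡0 P[r]≡0 ∷ divide-zero⇒zero r c′ cs P′[r]≡0 zeros

  roots⇒zero : (rs : List Carrier) → Unique rs → (cs : Poly) → length cs ≤ length rs →
               All (λ r → eval cs r ≡ 0#) rs → All (_≡ 0#) cs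
  roots⇒zero rs       _                   []       _         _                  = []
  roots⇒zero (r ∷ rs) (r∉rs ∷ rs-unique) (c ∷ cs) (s≤s |cs|≤|rs|) (P[r]≡0 ∷ P[rs]≡0) =
    divide-zero⇒zero r c cs P[r]≡0
      (roots⇒zero rs rs-unique (divide r cs) (subst (_≤ length rs) (sym (length-divide r cs)) |cs|≤|rs|)
                  (All.zipWith (λ (r≢r′ , P[r′]≡0) → quotient-root r≢r′ P[r′]≡0) (r∉rs , P[rs]≡0)))
    where
    quotient-root : ∀ {r′} → ¬ (r ≡ r′) → eval (c ∷ cs) r′ ≡ 0# → eval (divide r cs) r′ ≡ 0#
    quotient-root {r′} r≢r′ P[r′]≡0 = *-cancelˡ (λ r′-r≡0 → r≢r′ (sym (x-y≡0⇒x≡y r′ r r′-r≡0))) (begin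
      (r′ - r) * eval (divide r cs) r′         ≡⟨ +-identityˡ _ ⟨
      0# + (r′ - r) * eval (divide r cs) r′    ≡⟨ cong (_+ (r′ - r) * eval (divide r cs) r′) P[r]≡0 ⟨
      eval (c ∷ cs) r + (r′ - r) * eval (divide r cs) r′ ≡⟨ factor-theorem r c cs r′ ⟨
      eval (c ∷ cs) r′                         ≡⟨ P[r′]≡0 ⟩
      0#                                       ≡⟨ zeroʳ (r′ - r) ⟨
      (r′ - r) * 0#                            ∎)

  vanishing⇒zero : (cs : Poly) → length cs ≤ q → (∀ x → eval cs x ≡ 0#) → All (_≡ 0#) cs
  vanishing⇒zero cs |cs|≤q vanishing =
    roots⇒zero elements (UniqueP.tabulate⁺ to-injective) cs
               (subst (length cs ≤_) (sym (ListP.length-tabulate to)) |cs|≤q)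
               (AllP.tabulate⁺ (vanishing ∘ to))
    where
    elements = tabulate to

  sum-of-powers-nonvanishing : ∀ k (e : Fin k → ℕ) N → (∀ j → e j < N) → N < q →
                 ∃ λ x → ¬ (sumFin k (λ j → x ^ e j) + x ^ N ≡ 0#)
  sum-of-powers-nonvanishing k e N e<N N<q = ¬∀⇒∃¬ (λ x → sumFin k (λ j → x ^ e j) + x ^ N ≟ 0#) λ vanishing →
    ⊞-monomial-nonzero (powerSum k e) N (length-powerSum k e e<N)
      (vanishing⇒zero P (length-⊞ (powerSum k e) (monomial N) |powerSum|≤q |monomial|≤q)
                      (λ x → trans (eval-P x) (vanishing x)))
    where
    P = powerSum k e ⊞ monomial N
    eval-P : ∀ x → eval P x ≡ sumFin k (λ j → x ^ e j) + x ^ N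
    eval-P x = trans (eval-⊞ (powerSum k e) (monomial N) x)
                     (cong₂ _+_ (eval-powerSum k e x) (eval-monomial N x))
    |powerSum|≤q = ℕP.≤-trans (length-powerSum k e e<N) (ℕP.<⇒≤ N<q)
    |monomial|≤q = subst (_≤ q) (sym (length-monomial N)) N<q

  module Frobenius {p : ℕ} (p-prime : Prime p) (p·1#≡0# : p · 1# ≡ 0#) where
    private
      module Binomial = CommutativeSemiringBinomial commutativeSemiring

    n·x≡[n·1#]*x : ∀ n x → n · x ≡ (n · 1#) * x
    n·x≡[n·1#]*x n x = trans (cong (n ·_) (sym (*-identityˡ x))) (sym (·-assoc-* n 1# x))

    freshmans-dream : ∀ n → 0 < n → (∀ k → 0 < k → k < n → ∀ z → (n C k) · z ≡ 0#) →
                      ∀ x y → (x + y) ^ n ≡ x ^ n + y ^ n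
    freshmans-dream (suc n) _ inner≡0 x y = begin
      (x + y) ^ suc n                         ≡⟨ ^≡Exp^ (x + y) (suc n) ⟩
      (x + y) Exp.^ suc n                     ≡⟨ Binomial.theorem (suc n) x y ⟩
      t Fin.zero + Σ.sum (t ∘ Fin.suc)        ≡⟨ cong (t Fin.zero +_) (Σ.sum-init-last (t ∘ Fin.suc)) ⟩
      t Fin.zero + (Σ.sum (init (t ∘ Fin.suc)) + t (Fin.suc (Fin.fromℕ n)))
                                              ≡⟨ cong₂ (λ u v → t Fin.zero + (u + v)) middle≡0 last≡x^n ⟩
      t Fin.zero + (0# + x ^ suc n)           ≡⟨ cong₂ _+_ first≡y^n (+-identityˡ _) ⟩
      y ^ suc n + x ^ suc n                   ≡⟨ +-comm _ _ ⟩
      x ^ suc n + y ^ suc n                   ∎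
      where
      t = Binomial.binomialTerm x y (suc n)
      middle≡0 : Σ.sum (init (t ∘ Fin.suc)) ≡ 0#
      middle≡0 = trans (Σ.sum-cong-≗ (λ i → inner≡0 _ (s≤s z≤n) (s≤s (inner-index< i)) _))
                       (Σ.sum-replicate-zero n)
        where
        inner-index< : (i : Fin n) → Fin.toℕ (Fin.inject₁ i) < n
        inner-index< i = subst (_< n) (sym (FinP.toℕ-inject₁ i)) (FinP.toℕ<n i)
      last≡x^n : t (Fin.suc (Fin.fromℕ n)) ≡ x ^ suc n
      last≡x^n = begin
        t (Fin.suc (Fin.fromℕ n))
          ≡⟨ cong (λ k → (suc n C k) · (x Exp.^ k * y Exp.^ (suc n ∸ k))) (cong suc (FinP.toℕ-fromℕ n)) ⟩
        (suc n C suc n) · (x Exp.^ suc n * y Exp.^ (n ∸ n))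
          ≡⟨ cong (_· (x Exp.^ suc n * y Exp.^ (n ∸ n))) (nCn≡1 (suc n)) ⟩
        1 · (x Exp.^ suc n * y Exp.^ (n ∸ n))     ≡⟨ +-identityʳ _ ⟩
        x Exp.^ suc n * y Exp.^ (n ∸ n)           ≡⟨ cong (λ k → x Exp.^ suc n * y Exp.^ k) (ℕP.n∸n≡0 n) ⟩
        x Exp.^ suc n * 1#                        ≡⟨ *-identityʳ _ ⟩
        x Exp.^ suc n                             ≡⟨ ^≡Exp^ x (suc n) ⟨
        x ^ suc n                                 ∎
      first≡y^n : t Fin.zero ≡ y ^ suc n
      first≡y^n = begin
        1 · (1# * y Exp.^ suc n)  ≡⟨ +-identityʳ _ ⟩
        1# * y Exp.^ suc n        ≡⟨ *-identityˡ _ ⟩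
        y Exp.^ suc n             ≡⟨ ^≡Exp^ y (suc n) ⟨
        y ^ suc n                 ∎

    pCk·x≡0# : ∀ k → 0 < k → k < p → ∀ x → (p C k) · x ≡ 0#
    pCk·x≡0# k 0<k k<p x with prime∣pCk p-prime 0<k k<p
    ... | divides c pCk≡c*p = begin
      (p C k) · x                ≡⟨ n·x≡[n·1#]*x (p C k) x ⟩
      ((p C k) · 1#) * x         ≡⟨ cong (λ n → (n · 1#) * x) pCk≡c*p ⟩
      ((c ℕ.* p) · 1#) * x       ≡⟨ cong (_* x) (·1-homo-* c p) ⟩
      ((c · 1#) * (p · 1#)) * x  ≡⟨ cong (λ z → ((c · 1#) * z) * x) p·1#≡0# ⟩
      ((c · 1#) * 0#) * x        ≡⟨ cong (_* x) (zeroʳ (c · 1#)) ⟩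
      0# * x                     ≡⟨ zeroˡ x ⟩
      0#                         ∎

    frobenius : ∀ x y → (x + y) ^ p ≡ x ^ p + y ^ p
    frobenius = freshmans-dream p (ℕ.>-nonZero⁻¹ p {{prime⇒nonZero p-prime}}) pCk·x≡0#

    frobenius-^ : ∀ e x y → (x + y) ^ (p ℕ.^ e) ≡ x ^ (p ℕ.^ e) + y ^ (p ℕ.^ e)
    frobenius-^ zero    x y = trans (*-identityʳ (x + y)) (sym (cong₂ _+_ (*-identityʳ x) (*-identityʳ y)))
    frobenius-^ (suc e) x y = begin
      (x + y) ^ (p ℕ.* p ℕ.^ e)                   ≡⟨ ^-*-assoc (x + y) p (p ℕ.^ e) ⟨
      ((x + y) ^ p) ^ (p ℕ.^ e)                   ≡⟨ cong (_^ (p ℕ.^ e)) (frobenius x y) ⟩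
      (x ^ p + y ^ p) ^ (p ℕ.^ e)                 ≡⟨ frobenius-^ e (x ^ p) (y ^ p) ⟩
      (x ^ p) ^ (p ℕ.^ e) + (y ^ p) ^ (p ℕ.^ e)   ≡⟨ cong₂ _+_ (^-*-assoc x p _) (^-*-assoc y p _) ⟩
      x ^ (p ℕ.* p ℕ.^ e) + y ^ (p ℕ.* p ℕ.^ e)   ∎

    frobenius-sumFin : ∀ e k (f : Fin k → Carrier) → sumFin k f ^ (p ℕ.^ e) ≡ sumFin k (λ i → f i ^ (p ℕ.^ e))
    frobenius-sumFin e zero    f = 0#^n≡0# (ℕP.m^n>0 p {{prime⇒nonZero p-prime}} e)
    frobenius-sumFin e (suc k) f =
      trans (frobenius-^ e _ _) (cong (f Fin.zero ^ (p ℕ.^ e) +_) (frobenius-sumFin e k (f ∘ Fin.suc)))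

  module Subfield {p : ℕ} (p-prime : Prime p) (p·1#≡0# : p · 1# ≡ 0#) (m : ℕ) where
    open Frobenius p-prime p·1#≡0#

    InSub? : Decidable (InSub p m)
    InSub? x = x ^ (p ℕ.^ m) ≟ x

    InSub-0# : InSub p m 0#
    InSub-0# = 0#^n≡0# (ℕP.m^n>0 p {{prime⇒nonZero p-prime}} m)

    InSub-+ : ∀ {x y} → InSub p m x → InSub p m y → InSub p m (x + y)
    InSub-+ {x} {y} x∈ y∈ = trans (frobenius-^ m x y) (cong₂ _+_ x∈ y∈)

    InSub-* : ∀ {x y} → InSub p m x → InSub p m y → InSub p m (x * y)
    InSub-* {x} {y} x∈ y∈ = trans (^-distrib-* x y (p ℕ.^ m)) (cong₂ _*_ x∈ y∈)

    InSub-eval : ∀ {cs} → PolyOver p m cs → ∀ {x} → InSub p m x → InSub p m (eval cs x)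
    InSub-eval []          x∈ = InSub-0#
    InSub-eval (c∈ ∷ cs∈) x∈ = InSub-+ c∈ (InSub-* x∈ (InSub-eval cs∈ x∈))

    InSub-inverse : ∀ {u v} → ¬ (u ≡ 0#) → u * v ≡ 1# → InSub p m u → InSub p m v
    InSub-inverse {u} {v} u≢0 uv≡1 u∈ = *-cancelˡ u≢0 (begin
      u * v ^ Q        ≡⟨ cong (_* v ^ Q) u∈ ⟨
      u ^ Q * v ^ Q    ≡⟨ ^-distrib-* u v Q ⟨
      (u * v) ^ Q      ≡⟨ cong (_^ Q) uv≡1 ⟩
      1# ^ Q           ≡⟨ 1#^n≡1# Q ⟩
      1#               ≡⟨ uv≡1 ⟨
      u * v            ∎)
      where
      Q = p ℕ.^ m

    InSub-fixed : ∀ {x} → InSub p m x → ∀ j → x ^ (p ℕ.^ (j ℕ.* m)) ≡ x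
    InSub-fixed {x} x∈ zero    = *-identityʳ x
    InSub-fixed {x} x∈ (suc j) = begin
      x ^ (p ℕ.^ (m ℕ.+ j ℕ.* m))           ≡⟨ cong (x ^_) (ℕP.^-distribˡ-+-* p m (j ℕ.* m)) ⟩
      x ^ (p ℕ.^ m ℕ.* p ℕ.^ (j ℕ.* m))     ≡⟨ ^-*-assoc x (p ℕ.^ m) _ ⟨
      (x ^ p ℕ.^ m) ^ (p ℕ.^ (j ℕ.* m))     ≡⟨ cong (_^ (p ℕ.^ (j ℕ.* m))) x∈ ⟩
      x ^ (p ℕ.^ (j ℕ.* m))                 ≡⟨ InSub-fixed x∈ j ⟩
      x                                     ∎

  module Trace {p m n : ℕ} (p^[m*n]≡q : p ℕ.^ (m ℕ.* n) ≡ q)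
               (p-prime : Prime p) (1≤m : 1 ≤ m) (1≤n : 1 ≤ n) where

    p·1#≡0# : p · 1# ≡ 0#
    p·1#≡0# = p^r≡q⇒p·1#≡0# p (m ℕ.* n) p^[m*n]≡q

    open Frobenius p-prime p·1#≡0#
    open Subfield p-prime p·1#≡0# m public

    Tr-InSub : ∀ x → InSub p m (Tr p m n x)
    Tr-InSub x = begin
      Tr p m n x ^ p ℕ.^ m                              ≡⟨ frobenius-sumFin m n _ ⟩
      sumFin n (λ j → conjugate (Fin.toℕ j) ^ p ℕ.^ m)  ≡⟨ sumFin-cong n (next-conjugate ∘ Fin.toℕ) ⟩
      sumFin n (λ j → conjugate (suc (Fin.toℕ j)))      ≡⟨ sumFin-rotate n conjugate conjugate-n≡x ⟩
      Tr p m n x                                        ∎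
      where
      conjugate : ℕ → Carrier
      conjugate j = x ^ (p ℕ.^ (j ℕ.* m))
      next-conjugate : ∀ j → conjugate j ^ p ℕ.^ m ≡ conjugate (suc j)
      next-conjugate j = trans (^-*-assoc x (p ℕ.^ (j ℕ.* m)) (p ℕ.^ m))
        (cong (x ^_) (trans (sym (ℕP.^-distribˡ-+-* p (j ℕ.* m) m)) (cong (p ℕ.^_) (ℕP.+-comm (j ℕ.* m) m))))
      conjugate-n≡x : conjugate n ≡ conjugate 0
      conjugate-n≡x = begin
        x ^ (p ℕ.^ (n ℕ.* m))    ≡⟨ cong (λ e → x ^ (p ℕ.^ e)) (ℕP.*-comm n m) ⟩
        x ^ (p ℕ.^ (m ℕ.* n))    ≡⟨ cong (x ^_) p^[m*n]≡q ⟩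
        x ^ q                    ≡⟨ fermat x ⟩
        x                        ≡⟨ *-identityʳ x ⟨
        x ^ 1                    ∎

    Tr-+ : ∀ x y → Tr p m n (x + y) ≡ Tr p m n x + Tr p m n y
    Tr-+ x y = trans (sumFin-cong n (λ j → frobenius-^ (Fin.toℕ j ℕ.* m) x y)) (sumFin-distrib-+ n _ _)

    Tr-*-InSub : ∀ {c} → InSub p m c → ∀ x → Tr p m n (c * x) ≡ c * Tr p m n x
    Tr-*-InSub {c} c∈ x = begin
      sumFin n (λ j → (c * x) ^ P j)
        ≡⟨ sumFin-cong n (λ j → ^-distrib-* c x (P j)) ⟩
      sumFin n (λ j → c ^ P j * x ^ P j)
        ≡⟨ sumFin-cong n (λ j → cong (_* x ^ P j) (InSub-fixed c∈ (Fin.toℕ j))) ⟩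
      sumFin n (λ j → c * x ^ P j)
        ≡⟨ *-distribˡ-sumFin n c _ ⟨
      c * Tr p m n x
        ∎
      where
      P : Fin n → ℕ
      P j = p ℕ.^ (Fin.toℕ j ℕ.* m)

    -- Tr is a polynomial of degree p^((n-1)m) < q, so it cannot vanish on all of K.
    Tr-nonvanishing : ∃ λ x → ¬ (Tr p m n x ≡ 0#)
    Tr-nonvanishing = split-top-term (ℕP.suc-pred n {{ℕ.>-nonZero 1≤n}})
      where
      1<p = ℕ.nonTrivial⇒n>1 p {{prime⇒nonTrivial p-prime}}
      split-top-term : ∀ {n′} → suc n′ ≡ n → ∃ λ x → ¬ (Tr p m n x ≡ 0#)
      split-top-term {n′} refl =
        let x , x-nonroot = sum-of-powers-nonvanishing n′ lower-exponent (p ℕ.^ (n′ ℕ.* m)) lower<top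
                                   (subst (p ℕ.^ (n′ ℕ.* m) <_) p^[m*n]≡q top<q)
        in x , λ Tr[x]≡0 → x-nonroot (trans (sym (Tr-split x)) Tr[x]≡0)
        where
        lower-exponent : Fin n′ → ℕ
        lower-exponent j = p ℕ.^ (Fin.toℕ (Fin.inject₁ j) ℕ.* m)
        lower<top : ∀ j → lower-exponent j < p ℕ.^ (n′ ℕ.* m)
        lower<top j = ℕP.^-monoʳ-< p 1<p (ℕP.*-monoˡ-< m {{ℕ.>-nonZero 1≤m}}
                        (subst (_< n′) (sym (FinP.toℕ-inject₁ j)) (FinP.toℕ<n j)))
        top<q : p ℕ.^ (n′ ℕ.* m) < p ℕ.^ (m ℕ.* suc n′)
        top<q = ℕP.^-monoʳ-< p 1<p
                  (subst₂ _<_ (ℕP.*-comm m n′) (sym (ℕP.*-suc m n′)) (ℕP.m<n+m (m ℕ.* n′) 1≤m))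
        Tr-split : ∀ x → Tr p m (suc n′) x ≡ sumFin n′ (λ j → x ^ lower-exponent j) + x ^ (p ℕ.^ (n′ ℕ.* m))
        Tr-split x = trans (sumFin-init-last n′ (λ j → x ^ (p ℕ.^ (Fin.toℕ j ℕ.* m))))
                           (cong (λ i → lower-sum + x ^ (p ℕ.^ (i ℕ.* m))) (FinP.toℕ-fromℕ n′))
          where
          lower-sum = sumFin n′ (λ j → x ^ lower-exponent j)

    Tr-onto : ∀ y → InSub p m y → ∃ λ z → Tr p m n z ≡ y
    Tr-onto y y∈ = (y * v) * x₀ , (begin
      Tr p m n ((y * v) * x₀)   ≡⟨ Tr-*-InSub (InSub-* y∈ v∈) x₀ ⟩
      (y * v) * u               ≡⟨ *-assoc y v u ⟩
      y * (v * u)               ≡⟨ cong (y *_) (trans (*-comm v u) uv≡1) ⟩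
      y * 1#                    ≡⟨ *-identityʳ y ⟩
      y                         ∎)
      where
      x₀ = proj₁ Tr-nonvanishing
      u  = Tr p m n x₀
      u≢0 = proj₂ Tr-nonvanishing
      v  = proj₁ (inverse u u≢0)
      uv≡1 = proj₂ (inverse u u≢0)
      v∈ : InSub p m v
      v∈ = InSub-inverse u≢0 uv≡1 (Tr-InSub x₀)

  module AGWCriterion (p m : ℕ) (InSub? : Decidable (InSub p m)) (T : Carrier → Carrier)
           (T-into : ∀ x → InSub p m (T x)) (T-onto : ∀ y → InSub p m y → ∃ λ z → T z ≡ y)
           (h f₁ g : Carrier → Carrier)
           (f₁-fibre-injective : ∀ a → InSub p m a → ∀ x y → T x ≡ a → T y ≡ a → f₁ x ≡ f₁ y → x ≡ y)
           (g-into : ∀ a → InSub p m a → InSub p m (g a))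
           (T∘f≡g∘T : ∀ x → T (h (T x) + f₁ x) ≡ g (T x)) where

    f : Carrier → Carrier
    f x = h (T x) + f₁ x

    permutes⇒permutesSub : Permutes f → PermutesSub p m g
    permutes⇒permutesSub (_ , f-onto) = g-into , surjectiveOn⇒injectiveOn InSub? g g-onto , g-onto
      where
      g-onto : ∀ y → InSub p m y → ∃ λ x → InSub p m x × g x ≡ y
      g-onto y y∈ =
        let z , Tz≡y = T-onto y y∈
            w , fw≡z = f-onto z
        in T w , T-into w , trans (sym (T∘f≡g∘T w)) (trans (cong T fw≡z) Tz≡y)

    permutesSub⇒permutes : PermutesSub p m g → Permutes f
    permutesSub⇒permutes (_ , g-injective , _) = f-injective , injective⇒surjective f (f-injective _ _)
      where
      f-injective : ∀ x y → f x ≡ f y → x ≡ y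
      f-injective x y fx≡fy = f₁-fibre-injective (T x) (T-into x) x y refl (sym Tx≡Ty) f₁x≡f₁y
        where
        Tx≡Ty : T x ≡ T y
        Tx≡Ty = g-injective (T x) (T y) (T-into x) (T-into y)
                  (trans (sym (T∘f≡g∘T x)) (trans (cong T fx≡fy) (T∘f≡g∘T y)))
        f₁x≡f₁y : f₁ x ≡ f₁ y
        f₁x≡f₁y = +-cancelˡ (h (T x)) (f₁ x) (f₁ y) (trans fx≡fy (cong (λ a → h a + f₁ y) (sym Tx≡Ty)))

    inverse-formula : (ϕ ϕ̄ : Carrier → Carrier) → Permutes f →
                      (ginv : Carrier → Carrier) → InverseOnSub p m g ginv →
                      (Ψinv : Carrier → Carrier) → InverseOf (λ x → ϕ (f₁ x) + ϕ̄ (T x)) Ψinv →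
                      InverseOf f (λ x → Ψinv (ϕ (x - h (ginv (T x))) + ϕ̄ (ginv (T x))))
    inverse-formula ϕ ϕ̄ (_ , f-onto) ginv (_ , _ , ginv∘g) Ψinv (_ , Ψinv∘Ψ) = f∘finv , finv∘f
      where
      finv : Carrier → Carrier
      finv x = Ψinv (ϕ (x - h (ginv (T x))) + ϕ̄ (ginv (T x)))
      finv∘f : ∀ y → finv (f y) ≡ y
      finv∘f y = begin
        Ψinv (ϕ (f y - h (ginv (T (f y)))) + ϕ̄ (ginv (T (f y))))
          ≡⟨ cong (λ a → Ψinv (ϕ (f y - h a) + ϕ̄ a)) ginv[T[fy]]≡Ty ⟩
        Ψinv (ϕ (f y - h (T y)) + ϕ̄ (T y))
          ≡⟨ cong (λ z → Ψinv (ϕ z + ϕ̄ (T y))) (x+y-x≡y (h (T y)) (f₁ y)) ⟩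
        Ψinv (ϕ (f₁ y) + ϕ̄ (T y))
          ≡⟨ Ψinv∘Ψ y ⟩
        y ∎
        where
        ginv[T[fy]]≡Ty : ginv (T (f y)) ≡ T y
        ginv[T[fy]]≡Ty = trans (cong ginv (T∘f≡g∘T y)) (ginv∘g (T y) (T-into y))
      f∘finv : ∀ x → f (finv x) ≡ x
      f∘finv x with f-onto x
      ... | y , refl = cong f (finv∘f y)

  module TracePermutation {p m n k : ℕ} (p^[m*n]≡q : p ℕ.^ (m ℕ.* n) ≡ q)
           (p-prime : Prime p) (1≤m : 1 ≤ m) (1≤n : 1 ≤ n) (s t : Fin k → ℕ)
           (b : Fin k → Carrier) (b∈ : ∀ i → InSub p m (b i)) (δ : Carrier)
           (f₁ φ : Poly) (φ∈ : PolyOver p m φ)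
           (Tr∘f₁≡φ∘Tr : ∀ x → Tr p m n (eval f₁ x) ≡ eval φ (Tr p m n x))
           (f₁-fibre-injective : ∀ a → InSub p m a → ∀ x y → Tr p m n x ≡ a → Tr p m n y ≡ a →
                                 eval f₁ x ≡ eval f₁ y → x ≡ y) where
    open Trace p^[m*n]≡q p-prime 1≤m 1≤n
    open Frobenius p-prime p·1#≡0#

    h : Carrier → Carrier
    h x = sumFin k (λ i → b i * ((x ^ t i + δ) ^ s i))

    conjugateSum : Carrier → Carrier
    conjugateSum x = sumFin n (λ j → sumFin k (λ i →
                       b i * ((x ^ t i + δ) ^ (s i ℕ.* p ℕ.^ (m ℕ.* Fin.toℕ j)))))

    g : Carrier → Carrier
    g x = conjugateSum x + eval φ x

    Tr∘h≡conjugateSum : ∀ a → Tr p m n (h a) ≡ conjugateSum a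
    Tr∘h≡conjugateSum a = sumFin-cong n λ j →
      trans (frobenius-sumFin (Fin.toℕ j ℕ.* m) k _) (sumFin-cong k (conjugate-term (Fin.toℕ j)))
      where
      conjugate-term : ∀ j i → (b i * (a ^ t i + δ) ^ s i) ^ (p ℕ.^ (j ℕ.* m))
                               ≡ b i * (a ^ t i + δ) ^ (s i ℕ.* p ℕ.^ (m ℕ.* j))
      conjugate-term j i = begin
        (b i * Z ^ s i) ^ P               ≡⟨ ^-distrib-* (b i) (Z ^ s i) P ⟩
        b i ^ P * (Z ^ s i) ^ P           ≡⟨ cong₂ _*_ (InSub-fixed (b∈ i) j) (^-*-assoc Z (s i) P) ⟩
        b i * Z ^ (s i ℕ.* P)             ≡⟨ cong (λ e → b i * Z ^ (s i ℕ.* p ℕ.^ e)) (ℕP.*-comm j m) ⟩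
        b i * Z ^ (s i ℕ.* p ℕ.^ (m ℕ.* j)) ∎
        where
        Z = a ^ t i + δ
        P = p ℕ.^ (j ℕ.* m)

    Tr∘f≡g∘Tr : ∀ x → Tr p m n (h (Tr p m n x) + eval f₁ x) ≡ g (Tr p m n x)
    Tr∘f≡g∘Tr x = trans (Tr-+ _ (eval f₁ x)) (cong₂ _+_ (Tr∘h≡conjugateSum (Tr p m n x)) (Tr∘f₁≡φ∘Tr x))

    g-InSub : ∀ a → InSub p m a → InSub p m (g a)
    g-InSub a a∈ = subst (λ c → InSub p m (c + eval φ a)) (Tr∘h≡conjugateSum a)
                         (InSub-+ (Tr-InSub (h a)) (InSub-eval φ∈ a∈))

    open AGWCriterion p m InSub? (Tr p m n) Tr-InSub Tr-onto h (eval f₁) g f₁-fibre-injective g-InSub Tr∘f≡g∘Tr public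

lemma5 : (p m n k : ℕ) → Prime p → 1 ℕ.≤ m → 1 ℕ.≤ n → 1 ℕ.≤ k →
  (K : FiniteField (p ℕ.^ (m ℕ.* n))) →
  let open FieldOps K in
  (s t : Fin k → ℕ) → (∀ i → 1 ℕ.≤ s i) → (∀ i → 1 ℕ.≤ t i) →
  (b : Fin k → Carrier) → (∀ i → InSub p m (b i)) →
  (δ : Carrier) → (f₁ φ : Poly) → PolyOver p m φ →
  (∀ x → Tr p m n (eval f₁ x) ≡ eval φ (Tr p m n x)) →
  (∀ a → InSub p m a → ∀ x y → Tr p m n x ≡ a → Tr p m n y ≡ a →
    eval f₁ x ≡ eval f₁ y → x ≡ y) →
  let f : Carrier → Carrier
      f x = sumFin k (λ i → b i * ((Tr p m n x ^ t i + δ) ^ s i)) + eval f₁ x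
      g : Carrier → Carrier
      g x = sumFin n (λ j → sumFin k (λ i →
              b i * ((x ^ t i + δ) ^ (s i ℕ.* p ℕ.^ (m ℕ.* Data.Fin.toℕ j))))) + eval φ x
      h : Carrier → Carrier
      h x = sumFin k (λ i → b i * ((x ^ t i + δ) ^ s i))
  in (Permutes f ⇔ PermutesSub p m g) ×
     ((ϕ ϕ̄ : Poly) →
      Permutes f →
      Permutes (λ x → eval ϕ (eval f₁ x) + eval ϕ̄ (Tr p m n x)) →
      (ginv : Carrier → Carrier) → InverseOnSub p m g ginv →
      (Ψinv : Carrier → Carrier) →
      InverseOf (λ x → eval ϕ (eval f₁ x) + eval ϕ̄ (Tr p m n x)) Ψinv →
      InverseOf f (λ x → Ψinv (eval ϕ (x - h (ginv (Tr p m n x)))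
                               + eval ϕ̄ (ginv (Tr p m n x)))))
lemma5 p m n k p-prime 1≤m 1≤n _ K s t _ _ b b∈ δ f₁ φ φ∈ Tr∘f₁≡φ∘Tr f₁-fibre-injective =
  mk⇔ permutes⇒permutesSub permutesSub⇒permutes ,
  λ ϕ ϕ̄ f-permutes _ → inverse-formula (eval ϕ) (eval ϕ̄) f-permutes
  where
  open FieldOps K using (eval)
  open FiniteFieldTheory K
  open TracePermutation refl p-prime 1≤m 1≤n s t b b∈ δ f₁ φ φ∈ Tr∘f₁≡φ∘Tr f₁-fibre-injective
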